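{- For all integers $n$ and $i$ with $0 \leq i \leq n-3$, $x_{n - 2 + i} + x_{n - 1 - i} \leq x_{n - 1 + i} + x_{n - 2 - i}$.
   Context: The sequence $(x_n)_{n\ge1}$ is defined by $x_1 = 0, x_2 = 1, x_3 = 2, x_4 = 4, x_5 = 5$ and, for $n \geq 6$, $$x_n = (n - 1) + \begin{cases} x_{\frac{n + 1}{2}} + x_{\frac{n - 3}{2}}, & n \equiv 1 \pmod 4,\\ 2 x_{\frac{n - 1}{2}}, & n \equiv 3 \pmod 4,\\ x_{\frac{n}{2}} + x_{\frac{n - 2}{2}}, & n \text{ even}. \end{cases}$$ -}

module Defs where

open import Data.Nat using (ℕ; zero; suc; _+_; _∸_)
open import Data.Nat.DivMod using (_/_; _%_)
open import Data.Bool using (Bool; true; false; if_then_else_)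
open import Data.Nat using (_≡ᵇ_)

-- The sequence (x_n)_{n ≥ 1}:
--   x_1 = 0, x_2 = 1, x_3 = 2, x_4 = 4, x_5 = 5, and for n ≥ 6
--   x_n = (n-1) + x_{(n+1)/2} + x_{(n-3)/2}   if n ≡ 1 (mod 4)
--   x_n = (n-1) + 2 x_{(n-1)/2}               if n ≡ 3 (mod 4)
--   x_n = (n-1) + x_{n/2} + x_{(n-2)/2}       if n even.
-- x_0 is not part of the sequence; we set it to 0 (never used by the statement).
-- 'go fuel n' computes x_n provided fuel ≥ n (all recursive indices are < n).
go : ℕ → ℕ → ℕ
go zero    _ = 0
go (suc f) 0 = 0
go (suc f) 1 = 0
go (suc f) 2 = 1
go (suc f) 3 = 2
go (suc f) 4 = 4
go (suc f) 5 = 5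
go (suc f) n =
  if n % 4 ≡ᵇ 1 then (n ∸ 1) + (go f ((n + 1) / 2) + go f ((n ∸ 3) / 2))
  else if n % 4 ≡ᵇ 3 then (n ∸ 1) + (go f ((n ∸ 1) / 2) + go f ((n ∸ 1) / 2))
  else (n ∸ 1) + (go f (n / 2) + go f ((n ∸ 2) / 2))

x : ℕ → ℕ
x n = go n n

-- Write Δ_k = x_{k+1} − x_k; the inequality says Δ_{n−2−i} ≤ Δ_{n−2+i}, so it is
-- enough that Δ_k ≤ Δ_{k+2} for every k ≥ 1. Unfolding the recurrence gives
-- Δ_{4p+6} = 1 + Δ_{2p+2}, Δ_{4p+7} = 1 + Δ_{2p+3}, Δ_{4p+8} = 1 + Δ_{2p+4} and
-- Δ_{4p+9} = 1 + Δ_{2p+3}. Hence comparing Δ_k with Δ_{k+2} is either an equality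
-- or the same comparison at about half the index, and strong induction closes it.
module Submission where

open import Defs
open import Data.Bool using (if_then_else_)
open import Data.Nat using (ℕ; zero; suc; _+_; _*_; _∸_; _≤_; _<_; _≡ᵇ_; z≤n; s≤s)
open import Data.Nat.Properties
  using (≤-refl; ≤-reflexive; ≤-trans; ≤-pred; n≤1+n; m∸n≤m; m≤n+m; m≤m*n; *-monoʳ-≤;
         +-comm; +-suc; +-assoc; *-assoc; *-distribʳ-+; m+n∸n≡m; m≤n⇒∃[o]m+o≡n)
open import Data.Nat.DivMod using (_/_; _%_; [m+kn]%n≡m%n; m*n/n≡m; m<n*o⇒m/o<n)
open import Data.Nat.Induction using (<-rec)
open import Data.Nat.Tactic.RingSolver using (solve-∀)
open import Data.Integer as ℤ using (ℤ; +_; _⊖_)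
open import Data.Integer.Properties as ℤ
  using (+-cancelˡ-⊖; distribˡ-⊖-+-pos; distribʳ-⊖-+-pos; ≤-⊖; drop‿+≤+)
open import Data.Product using (∃-syntax; _,_)
open import Data.Sum using (_⊎_; inj₁; inj₂)
open import Relation.Binary.PropositionalEquality
  using (_≡_; refl; sym; trans; cong; cong₂; subst; module ≡-Reasoning)

recurrence : (ℕ → ℕ) → ℕ → ℕ
recurrence g n =
  if n % 4 ≡ᵇ 1 then (n ∸ 1) + (g ((n + 1) / 2) + g ((n ∸ 3) / 2))
  else if n % 4 ≡ᵇ 3 then (n ∸ 1) + (g ((n ∸ 1) / 2) + g ((n ∸ 1) / 2))
  else (n ∸ 1) + (g (n / 2) + g ((n ∸ 2) / 2))

a≤1+n⇒a/2<n : ∀ {a n} → 2 ≤ n → a ≤ suc n → a / 2 < n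
a≤1+n⇒a/2<n (s≤s (s≤s {n = m} _)) a≤1+n =
  m<n*o⇒m/o<n (≤-trans (s≤s a≤1+n) (s≤s (s≤s (s≤s (s≤s (m≤m*n m 2))))))

recurrence-local : ∀ {g h} n → 2 ≤ n → (∀ k → k < n → g k ≡ h k) →
                   recurrence g n ≡ recurrence h n
recurrence-local n 2≤n g≗h
  rewrite g≗h ((n + 1) / 2) (a≤1+n⇒a/2<n 2≤n (≤-reflexive (+-comm n 1)))
        | g≗h ((n ∸ 3) / 2) (a≤1+n⇒a/2<n 2≤n (≤-trans (m∸n≤m n 3) (n≤1+n n)))
        | g≗h ((n ∸ 1) / 2) (a≤1+n⇒a/2<n 2≤n (≤-trans (m∸n≤m n 1) (n≤1+n n)))
        | g≗h (n / 2)       (a≤1+n⇒a/2<n 2≤n (n≤1+n n))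
        | g≗h ((n ∸ 2) / 2) (a≤1+n⇒a/2<n 2≤n (≤-trans (m∸n≤m n 2) (n≤1+n n))) = refl

go-fuel-irrelevant : ∀ f f′ n → n ≤ f → n ≤ f′ → go f n ≡ go f′ n
go-fuel-irrelevant zero    zero     _ z≤n z≤n = refl
go-fuel-irrelevant zero    (suc f′) _ z≤n _   = refl
go-fuel-irrelevant (suc f) zero     _ _   z≤n = refl
go-fuel-irrelevant (suc f) (suc f′) 0 _ _ = refl
go-fuel-irrelevant (suc f) (suc f′) 1 _ _ = refl
go-fuel-irrelevant (suc f) (suc f′) 2 _ _ = refl
go-fuel-irrelevant (suc f) (suc f′) 3 _ _ = refl
go-fuel-irrelevant (suc f) (suc f′) 4 _ _ = refl
go-fuel-irrelevant (suc f) (suc f′) 5 _ _ = refl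
go-fuel-irrelevant (suc f) (suc f′) n@(suc (suc (suc (suc (suc (suc _)))))) n≤f n≤f′ =
  recurrence-local n (s≤s (s≤s z≤n)) λ k k<n →
    go-fuel-irrelevant f f′ k (≤-pred (≤-trans k<n n≤f)) (≤-pred (≤-trans k<n n≤f′))

x-recurrence : ∀ m → x (6 + m) ≡ recurrence x (6 + m)
x-recurrence m = recurrence-local (6 + m) (s≤s (s≤s z≤n)) λ k k<n →
  go-fuel-irrelevant (5 + m) k k (≤-pred k<n) ≤-refl

halve : ∀ r p → (r * 2 + p * 4) / 2 ≡ r + p * 2
halve r p = begin
  (r * 2 + p * 4) / 2     ≡⟨ cong (λ s → (r * 2 + s) / 2) (sym (*-assoc p 2 2)) ⟩
  (r * 2 + p * 2 * 2) / 2 ≡⟨ cong (_/ 2) (sym (*-distribʳ-+ 2 r (p * 2))) ⟩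
  (r + p * 2) * 2 / 2     ≡⟨ m*n/n≡m (r + p * 2) 2 ⟩
  r + p * 2               ∎
  where open ≡-Reasoning

recurrence-even : ∀ g n → n % 4 ≡ 0 ⊎ n % 4 ≡ 2 →
                  recurrence g n ≡ n ∸ 1 + (g (n / 2) + g ((n ∸ 2) / 2))
recurrence-even g n (inj₁ n%4≡0) rewrite n%4≡0 = refl
recurrence-even g n (inj₂ n%4≡2) rewrite n%4≡2 = refl

recurrence-1 : ∀ g n → n % 4 ≡ 1 →
               recurrence g n ≡ n ∸ 1 + (g ((n + 1) / 2) + g ((n ∸ 3) / 2))
recurrence-1 g n n%4≡1 rewrite n%4≡1 = refl

recurrence-3 : ∀ g n → n % 4 ≡ 3 →
               recurrence g n ≡ n ∸ 1 + (g ((n ∸ 1) / 2) + g ((n ∸ 1) / 2))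
recurrence-3 g n n%4≡3 rewrite n%4≡3 = refl

-- Indices are written p * 4 because suc p * 4 reduces to 4 + p * 4: the lemmas at
-- suc p then give the cases 10 + p * 4 and 11 + p * 4 for free.
x[6+p*4] : ∀ p → x (6 + p * 4) ≡ 5 + p * 4 + (x (3 + p * 2) + x (2 + p * 2))
x[6+p*4] p = begin
  x (6 + p * 4)
    ≡⟨ x-recurrence (p * 4) ⟩
  recurrence x (6 + p * 4)
    ≡⟨ recurrence-even x (6 + p * 4) (inj₂ ([m+kn]%n≡m%n 6 p 4)) ⟩
  5 + p * 4 + (x ((6 + p * 4) / 2) + x ((4 + p * 4) / 2))
    ≡⟨ cong₂ (λ a b → 5 + p * 4 + (x a + x b)) (halve 3 p) (halve 2 p) ⟩
  5 + p * 4 + (x (3 + p * 2) + x (2 + p * 2)) ∎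
  where open ≡-Reasoning

x[7+p*4] : ∀ p → x (7 + p * 4) ≡ 6 + p * 4 + (x (3 + p * 2) + x (3 + p * 2))
x[7+p*4] p = begin
  x (7 + p * 4)
    ≡⟨ x-recurrence (1 + p * 4) ⟩
  recurrence x (7 + p * 4)
    ≡⟨ recurrence-3 x (7 + p * 4) ([m+kn]%n≡m%n 7 p 4) ⟩
  6 + p * 4 + (x ((6 + p * 4) / 2) + x ((6 + p * 4) / 2))
    ≡⟨ cong (λ a → 6 + p * 4 + (x a + x a)) (halve 3 p) ⟩
  6 + p * 4 + (x (3 + p * 2) + x (3 + p * 2)) ∎
  where open ≡-Reasoning

x[8+p*4] : ∀ p → x (8 + p * 4) ≡ 7 + p * 4 + (x (4 + p * 2) + x (3 + p * 2))
x[8+p*4] p = begin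
  x (8 + p * 4)
    ≡⟨ x-recurrence (2 + p * 4) ⟩
  recurrence x (8 + p * 4)
    ≡⟨ recurrence-even x (8 + p * 4) (inj₁ ([m+kn]%n≡m%n 8 p 4)) ⟩
  7 + p * 4 + (x ((8 + p * 4) / 2) + x ((6 + p * 4) / 2))
    ≡⟨ cong₂ (λ a b → 7 + p * 4 + (x a + x b)) (halve 4 p) (halve 3 p) ⟩
  7 + p * 4 + (x (4 + p * 2) + x (3 + p * 2)) ∎
  where open ≡-Reasoning

x[9+p*4] : ∀ p → x (9 + p * 4) ≡ 8 + p * 4 + (x (5 + p * 2) + x (3 + p * 2))
x[9+p*4] p = begin
  x (9 + p * 4)
    ≡⟨ x-recurrence (3 + p * 4) ⟩
  recurrence x (9 + p * 4)
    ≡⟨ recurrence-1 x (9 + p * 4) ([m+kn]%n≡m%n 9 p 4) ⟩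
  8 + p * 4 + (x ((9 + p * 4 + 1) / 2) + x ((6 + p * 4) / 2))
    ≡⟨ cong (λ a → 8 + p * 4 + (x (a / 2) + x ((6 + p * 4) / 2))) (+-comm (9 + p * 4) 1) ⟩
  8 + p * 4 + (x ((10 + p * 4) / 2) + x ((6 + p * 4) / 2))
    ≡⟨ cong₂ (λ a b → 8 + p * 4 + (x a + x b)) (halve 5 p) (halve 3 p) ⟩
  8 + p * 4 + (x (5 + p * 2) + x (3 + p * 2)) ∎
  where open ≡-Reasoning

Δ : (ℕ → ℕ) → ℕ → ℤ
Δ f n = f (suc n) ⊖ f n

+-cancelʳ-⊖ : ∀ m n o → (m + o) ⊖ (n + o) ≡ m ⊖ n
+-cancelʳ-⊖ m n o = trans (cong₂ _⊖_ (+-comm m o) (+-comm n o)) (+-cancelˡ-⊖ o m n)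

[1+c+u]⊖[c+v]≡suc[u⊖v] : ∀ c u v → (suc c + u) ⊖ (c + v) ≡ ℤ.suc (u ⊖ v)
[1+c+u]⊖[c+v]≡suc[u⊖v] c u v = begin
  (suc c + u) ⊖ (c + v)   ≡⟨ cong (_⊖ (c + v)) (sym (+-suc c u)) ⟩
  (c + suc u) ⊖ (c + v)   ≡⟨ +-cancelˡ-⊖ c (suc u) v ⟩
  suc u ⊖ v               ≡⟨ sym (distribʳ-⊖-+-pos 1 u v) ⟩
  ℤ.suc (u ⊖ v)           ∎
  where open ≡-Reasoning

Δ≡suc[u⊖v] : ∀ f n c {u v} → f (suc n) ≡ suc c + u → f n ≡ c + v → Δ f n ≡ ℤ.suc (u ⊖ v)
Δ≡suc[u⊖v] f n c {u} {v} fsn fn = trans (cong₂ _⊖_ fsn fn) ([1+c+u]⊖[c+v]≡suc[u⊖v] c u v)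

Δ[6+p*4] : ∀ p → Δ x (6 + p * 4) ≡ ℤ.suc (Δ x (2 + p * 2))
Δ[6+p*4] p = trans (Δ≡suc[u⊖v] x (6 + p * 4) (5 + p * 4) (x[7+p*4] p) (x[6+p*4] p))
                   (cong ℤ.suc (+-cancelˡ-⊖ (x (3 + p * 2)) (x (3 + p * 2)) (x (2 + p * 2))))

Δ[7+p*4] : ∀ p → Δ x (7 + p * 4) ≡ ℤ.suc (Δ x (3 + p * 2))
Δ[7+p*4] p = trans (Δ≡suc[u⊖v] x (7 + p * 4) (6 + p * 4) (x[8+p*4] p) (x[7+p*4] p))
                   (cong ℤ.suc (+-cancelʳ-⊖ (x (4 + p * 2)) (x (3 + p * 2)) (x (3 + p * 2))))

Δ[8+p*4] : ∀ p → Δ x (8 + p * 4) ≡ ℤ.suc (Δ x (4 + p * 2))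
Δ[8+p*4] p = trans (Δ≡suc[u⊖v] x (8 + p * 4) (7 + p * 4) (x[9+p*4] p) (x[8+p*4] p))
                   (cong ℤ.suc (+-cancelʳ-⊖ (x (5 + p * 2)) (x (4 + p * 2)) (x (3 + p * 2))))

Δ[9+p*4] : ∀ p → Δ x (9 + p * 4) ≡ ℤ.suc (Δ x (3 + p * 2))
Δ[9+p*4] p = trans (Δ≡suc[u⊖v] x (9 + p * 4) (8 + p * 4) (x[6+p*4] (suc p)) (x[9+p*4] p))
                   (cong ℤ.suc (+-cancelˡ-⊖ (x (5 + p * 2)) (x (4 + p * 2)) (x (3 + p * 2))))

data Residue4 : ℕ → Set where
  rem0 : ∀ p → Residue4 (p * 4)
  rem1 : ∀ p → Residue4 (1 + p * 4)
  rem2 : ∀ p → Residue4 (2 + p * 4)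
  rem3 : ∀ p → Residue4 (3 + p * 4)

residue4 : ∀ q → Residue4 q
residue4 zero = rem0 0
residue4 (suc q) with residue4 q
... | rem0 p = rem1 p
... | rem1 p = rem2 p
... | rem2 p = rem3 p
... | rem3 p = rem0 (suc p)

p*2≤r+p*4 : ∀ p r → p * 2 ≤ r + p * 4
p*2≤r+p*4 p r = ≤-trans (*-monoʳ-≤ p (s≤s (s≤s z≤n))) (m≤n+m (p * 4) r)

Δx[1+k]≤Δx[3+k] : ∀ k → Δ x (suc k) ℤ.≤ Δ x (3 + k)
Δx[1+k]≤Δx[3+k] = <-rec _ step
  where
  open ℤ.≤-Reasoning
  step : ∀ k → (∀ {j} → j < k → Δ x (suc j) ℤ.≤ Δ x (3 + j)) → Δ x (suc k) ℤ.≤ Δ x (3 + k)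
  -- Δx 1, …, Δx 7 are 1, 1, 2, 1, 3, 2, 3.
  step 0 _ = ℤ.+≤+ (s≤s z≤n)
  step 1 _ = ℤ.+≤+ (s≤s z≤n)
  step 2 _ = ℤ.+≤+ (s≤s (s≤s z≤n))
  step 3 _ = ℤ.+≤+ (s≤s z≤n)
  step 4 _ = ℤ.+≤+ (s≤s (s≤s (s≤s z≤n)))
  step (suc (suc (suc (suc (suc q))))) ih with residue4 q
  ... | rem0 p = begin
    Δ x (6 + p * 4)           ≡⟨ Δ[6+p*4] p ⟩
    ℤ.suc (Δ x (2 + p * 2))   ≤⟨ ℤ.suc-mono (ih (s≤s (s≤s (p*2≤r+p*4 p 3)))) ⟩
    ℤ.suc (Δ x (4 + p * 2))   ≡⟨ Δ[8+p*4] p ⟨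
    Δ x (8 + p * 4)           ∎
  ... | rem1 p = ℤ.≤-reflexive (trans (Δ[7+p*4] p) (sym (Δ[9+p*4] p)))
  ... | rem2 p = ℤ.≤-reflexive (trans (Δ[8+p*4] p) (sym (Δ[6+p*4] (suc p))))
  ... | rem3 p = begin
    Δ x (9 + p * 4)           ≡⟨ Δ[9+p*4] p ⟩
    ℤ.suc (Δ x (3 + p * 2))   ≤⟨ ℤ.suc-mono (ih (s≤s (s≤s (s≤s (p*2≤r+p*4 p 5))))) ⟩
    ℤ.suc (Δ x (5 + p * 2))   ≡⟨ Δ[7+p*4] (suc p) ⟨
    Δ x (11 + p * 4)          ∎

Δ[k]≤Δ[i*2+k] : ∀ f → (∀ k → Δ f k ℤ.≤ Δ f (2 + k)) → ∀ k i → Δ f k ℤ.≤ Δ f (i * 2 + k)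
Δ[k]≤Δ[i*2+k] f mono k zero    = ℤ.≤-refl
Δ[k]≤Δ[i*2+k] f mono k (suc i) = ℤ.≤-trans (Δ[k]≤Δ[i*2+k] f mono k i) (mono (i * 2 + k))

⊖-+-cancel : ∀ m n k → m ⊖ n ℤ.+ + (k + n) ≡ + (m + k)
⊖-+-cancel m n k = begin
  m ⊖ n ℤ.+ + (k + n)   ≡⟨ distribˡ-⊖-+-pos (k + n) m n ⟩
  m + (k + n) ⊖ n       ≡⟨ cong (_⊖ n) (+-assoc m k n) ⟨
  m + k + n ⊖ n         ≡⟨ ≤-⊖ (m≤n+m n (m + k)) ⟩
  + (m + k + n ∸ n)     ≡⟨ cong +_ (m+n∸n≡m (m + k) n) ⟩
  + (m + k)             ∎
  where open ≡-Reasoning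

m⊖n≤p⊖q⇒m+q≤p+n : ∀ {m n p q} → m ⊖ n ℤ.≤ p ⊖ q → m + q ≤ p + n
m⊖n≤p⊖q⇒m+q≤p+n {m} {n} {p} {q} m⊖n≤p⊖q = drop‿+≤+ (begin
  + (m + q)             ≡⟨ ⊖-+-cancel m n q ⟨
  m ⊖ n ℤ.+ + (q + n)   ≤⟨ ℤ.+-monoˡ-≤ (+ (q + n)) m⊖n≤p⊖q ⟩
  p ⊖ q ℤ.+ + (q + n)   ≡⟨ cong (λ s → p ⊖ q ℤ.+ + s) (+-comm q n) ⟩
  p ⊖ q ℤ.+ + (n + q)   ≡⟨ ⊖-+-cancel p q n ⟩
  + (p + n)             ∎)
  where open ℤ.≤-Reasoning

Δ≤Δ⇒+≤+ : ∀ f j k → Δ f j ℤ.≤ Δ f k → f k + f (suc j) ≤ f (suc k) + f j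
Δ≤Δ⇒+≤+ f j k Δj≤Δk = subst (_≤ f (suc k) + f j) (+-comm (f (suc j)) (f k))
  (m⊖n≤p⊖q⇒m+q≤p+n {f (suc j)} {f j} {f (suc k)} {f k} Δj≤Δk)

-- Shifting to x ∘ suc keeps the junk value x 0 out of the argument.
Δx[1+t]≤Δx[1+t+i+i] : ∀ t i → Δ x (suc t) ℤ.≤ Δ x (suc t + i + i)
Δx[1+t]≤Δx[1+t+i+i] t i = subst (λ k → Δ x (suc t) ℤ.≤ Δ x (suc k)) (i*2+t≡t+i+i i t)
  (Δ[k]≤Δ[i*2+k] (λ n → x (suc n)) Δx[1+k]≤Δx[3+k] t i)
  where
  i*2+t≡t+i+i : ∀ i t → i * 2 + t ≡ t + i + i
  i*2+t≡t+i+i = solve-∀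

i+3≤n⇒n≡3+[t+i] : ∀ {i n} → i + 3 ≤ n → ∃[ t ] n ≡ 3 + (t + i)
i+3≤n⇒n≡3+[t+i] {i} i+3≤n with m≤n⇒∃[o]m+o≡n i+3≤n
... | t , refl = t , i+3+t≡3+[t+i] i t
  where
  i+3+t≡3+[t+i] : ∀ i t → i + 3 + t ≡ 3 + (t + i)
  i+3+t≡3+[t+i] = solve-∀

lemma9 : (n i : ℕ) → i + 3 ≤ n →
         x (n ∸ 2 + i) + x (n ∸ 1 ∸ i) ≤ x (n ∸ 1 + i) + x (n ∸ 2 ∸ i)
lemma9 n i i+3≤n with i+3≤n⇒n≡3+[t+i] i+3≤n
... | t , refl rewrite m+n∸n≡m (2 + t) i | m+n∸n≡m (1 + t) i =
  Δ≤Δ⇒+≤+ x (suc t) (suc t + i + i) (Δx[1+t]≤Δx[1+t+i+i] t i)
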